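{- Let $V\models$ ZF, $\mathcal A$ a realizability algebra in $V$, and $\mathcal N=(V,\mathcal A)$. If $\alpha=\beta+1$ are ordinals of $V$, then $\mathcal N\Vdash$ "$\mathsf r(\alpha)$ is the $\in$-successor of $\mathsf r(\beta)$", that is, $\mathcal N\Vdash\mathsf r(\alpha)\simeq\mathsf r(\beta)+1$, where $x+1$ denotes (a set extensionally equal to) $x\cup\{x\}$.
   Context: Realizability algebra $\mathcal A=(A,B,\prec,\perp\!\!\!\perp)$ in $V$ (Krivine): $\Lambda$ is the set of closed $\lambda_c$-terms (built from variables, application, abstraction, $\mathsf{cc}$, continuation constants $k_\pi$, special instructions), $\Pi$ is the set of stacks, $\prec$ is a preorder on processes $t\star\pi$ extending $ts\star\pi\succ t\star s.\pi$, $\lambda u.t\star s.\pi\succ t[u:=s]\star\pi$, $\mathsf{cc}\star t.\pi\succ t\star k_\pi.\pi$, $k_\sigma\star t.\pi\succ t\star\sigma$, and the pole is upward closed under $\succ$. Realizers are closed terms without continuation constants. Names: $N_\alpha=\bigcup_{\beta<\alpha}\mathcal P(N_\beta\times\Pi)$, $N=\bigcup N_\alpha$. The reish name is $\mathsf r(x)=\{(\mathsf r(y),\pi):y\in x,\pi\in\Pi\}$. Falsity values: - $\|a\not\varepsilon b\|=\{\pi:(a,\pi)\in b\}$; - $\|a\neq b\|\in\{\emptyset,\Pi\}$ according as $a\ne b$ or $a=b$; - $\|a\notin b\|=\bigcup_{c\in\mathrm{dom}(b)}\{t.t'.\pi:(c,\pi)\in b,t\Vdash a\subseteq c,t'\Vdash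 c\subseteq a\}$; - $\|a\subseteq b\|=\bigcup_{c\in\mathrm{dom}(a)}\{t.\pi:(c,\pi)\in a,t\Vdash c\notin b\}$; - $\|\varphi\to\psi\|=\{t.\pi:t\Vdash\varphi,\pi\in\|\psi\|\}$, $\|\forall x\varphi\|=\bigcup_{a\in N}\|\varphi(a)\|$. Here $t\Vdash\varphi$ iff $t\star\pi\in\perp\!\!\!\perp$ for all $\pi\in\|\varphi\|$. $\mathcal N\Vdash\varphi$ means some realizer realizes $\varphi$. The realized theory contains ZF$_\varepsilon$, in which $\in$ is the extensional membership and $\simeq$ extensional equality (with $a\simeq b$ abbreviating $\neg(a\subseteq b\to\neg b\subseteq a)$); $(\in,\simeq)$ is a model of ZF. -}

module Defs where

open import Level using (Level; Lift; lift) renaming (zero to lzero; suc to lsuc)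
open import Data.Nat using (ℕ; zero; suc)
open import Data.Fin using (Fin; zero; suc)
open import Data.Product using (Σ; _×_; _,_; proj₁; proj₂)
open import Data.Sum using (_⊎_)
open import Relation.Binary.PropositionalEquality using (_≡_)

-- We take V to be Aczel's cumulative hierarchy of
-- well-founded sets built in Agda's Set (a model of (constructive) set
-- theory), with extensional equality _≐_ and membership _∈ᵥ_.

data VSet : Set₁ where
  sup : (I : Set) → (I → VSet) → VSet

_≐_ : VSet → VSet → Set
sup I f ≐ sup J g = (∀ i → Σ J λ j → f i ≐ g j) × (∀ j → Σ I λ i → f i ≐ g j)

_∈ᵥ_ : VSet → VSet → Set
x ∈ᵥ sup I f = Σ I λ i → x ≐ f i

IsTransitive : VSet → Set₁
IsTransitive x = ∀ y → y ∈ᵥ x → ∀ z → z ∈ᵥ y → z ∈ᵥ x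

-- von Neumann ordinal (sets are well-founded): a transitive set of
-- transitive sets.
IsOrdinal : VSet → Set₁
IsOrdinal x = IsTransitive x × (∀ y → y ∈ᵥ x → IsTransitive y)

IsSuccessorOf : VSet → VSet → Set₁
IsSuccessorOf α β = ∀ x → (x ∈ᵥ α → (x ∈ᵥ β ⊎ x ≐ β)) × ((x ∈ᵥ β ⊎ x ≐ β) → x ∈ᵥ α)

-- Syntax: λ_c-terms (de Bruijn), stacks, names, formulas.
-- Ins = set of special instructions, Bot = set of stack bottoms.

module Syntax (Ins Bot : Set) where

  infixl 7 _·_
  infixr 5 _∷_

  mutual
    data Term (n : ℕ) : Set where
      var : Fin n → Term n
      _·_ : Term n → Term n → Term n
      lam : Term (suc n) → Term n
      cc  : Term n
      k   : Stack → Term n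
      ins : Ins → Term n

    data Stack : Set where
      bot : Bot → Stack
      _∷_ : Term 0 → Stack → Stack

  Λ : Set
  Λ = Term 0

  liftRen : ∀ {n m} → (Fin n → Fin m) → Fin (suc n) → Fin (suc m)
  liftRen ρ zero    = zero
  liftRen ρ (suc i) = suc (ρ i)

  ren : ∀ {n m} → (Fin n → Fin m) → Term n → Term m
  ren ρ (var i) = var (ρ i)
  ren ρ (t · u) = ren ρ t · ren ρ u
  ren ρ (lam t) = lam (ren (liftRen ρ) t)
  ren ρ cc      = cc
  ren ρ (k π)   = k π
  ren ρ (ins a) = ins a

  liftSub : ∀ {n m} → (Fin n → Term m) → Fin (suc n) → Term (suc m)
  liftSub σ zero    = var zero
  liftSub σ (suc i) = ren suc (σ i)

  sub : ∀ {n m} → (Fin n → Term m) → Term n → Term m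
  sub σ (var i) = σ i
  sub σ (t · u) = sub σ t · sub σ u
  sub σ (lam t) = lam (sub (liftSub σ) t)
  sub σ cc      = cc
  sub σ (k π)   = k π
  sub σ (ins a) = ins a

  _[0:=_] : Term 1 → Λ → Λ
  t [0:= s ] = sub (λ { zero → s }) t

  NoCont : ∀ {n} → Term n → Set
  NoCont (var i) = Data.Unit.⊤ where import Data.Unit
  NoCont (t · u) = NoCont t × NoCont u
  NoCont (lam t) = NoCont t
  NoCont cc      = Data.Unit.⊤ where import Data.Unit
  NoCont (k π)   = Data.Empty.⊥ where import Data.Empty
  NoCont (ins a) = Data.Unit.⊤ where import Data.Unit

  Process : Set
  Process = Λ × Stack

  _⋆_ : Λ → Stack → Process
  t ⋆ π = t , π

  -- Names: hereditarily sets of pairs (name , stack).  A name is given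
  -- by an index family of pairs (el i , st i).
  data Name : Set₁ where
    sup : (I : Set) → (I → Name) → (I → Stack) → Name

  _≈_ : Name → Name → Set
  sup I f s ≈ sup J g u =
    (∀ i → Σ J λ j → (f i ≈ g j) × (s i ≡ u j)) ×
    (∀ j → Σ I λ i → (f i ≈ g j) × (s i ≡ u j))

  reish : VSet → Name
  reish (sup I f) = sup (I × Stack) (λ p → reish (f (proj₁ p))) proj₂

  -- Formulas of the language of ZF_ε with parameters in N (HOAS binders)
  infixr 4 _⇒_
  data Formula : Set₁ where
    _ε̸_ : Name → Name → Formula
    _≠_  : Name → Name → Formula
    _∉_  : Name → Name → Formula
    _⊆_  : Name → Name → Formula
    _⇒_  : Formula → Formula → Formula
    ∀'   : (Name → Formula) → Formula

  -- derived connectives (Krivine's conventions)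
  ⊥' : Formula
  ⊥' = ∀' λ x → x ≠ x

  ¬' : Formula → Formula
  ¬' φ = φ ⇒ ⊥'

  _∧'_ : Formula → Formula → Formula
  φ ∧' ψ = ¬' (φ ⇒ ¬' ψ)

  _∨'_ : Formula → Formula → Formula
  φ ∨' ψ = ¬' φ ⇒ ¬' ψ ⇒ ⊥'

  _⇔'_ : Formula → Formula → Formula
  φ ⇔' ψ = (φ ⇒ ψ) ∧' (ψ ⇒ φ)

  ∃' : (Name → Formula) → Formula
  ∃' φ = ¬' (∀' λ x → ¬' (φ x))

  _∈'_ : Name → Name → Formula
  a ∈' b = ¬' (a ∉ b)

  _≃'_ : Name → Name → Formula
  a ≃' b = ¬' (a ⊆ b ⇒ ¬' (b ⊆ a))

  IsSucc' : Name → Name → Formula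
  IsSucc' y x = ∀' λ z → (z ∈' y) ⇔' ((z ∈' x) ∨' (z ≃' x))

  _≃Succ_ : Name → Name → Formula
  a ≃Succ b = ∃' λ y → IsSucc' y b ∧' (a ≃' y)

record RealizabilityAlgebra (Ins Bot : Set) : Set₁ where
  open Syntax Ins Bot
  field
    _≻_      : Process → Process → Set
    ≻-refl   : ∀ p → p ≻ p
    ≻-trans  : ∀ {p q r} → p ≻ q → q ≻ r → p ≻ r
    ≻-push   : ∀ t s π → ((t · s) ⋆ π) ≻ (t ⋆ (s ∷ π))
    ≻-grab   : ∀ t s π → (lam t ⋆ (s ∷ π)) ≻ ((t [0:= s ]) ⋆ π)
    ≻-save   : ∀ t π → (cc ⋆ (t ∷ π)) ≻ (t ⋆ (k π ∷ π))
    ≻-restore : ∀ σ t π → (k σ ⋆ (t ∷ π)) ≻ (t ⋆ σ)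
    Pole     : Process → Set
    Pole-closed : ∀ {p q} → p ≻ q → Pole q → Pole p

module Semantics {Ins Bot : Set} (𝒜 : RealizabilityAlgebra Ins Bot) where
  open Syntax Ins Bot
  open RealizabilityAlgebra 𝒜

  _⊩ᵖ_ : Λ → (Stack → Set₁) → Set₁
  t ⊩ᵖ P = ∀ π → P π → Pole (t ⋆ π)

  notinF : Name → Name → Stack → Set₁
  subF   : Name → Name → Stack → Set₁
  notinF a (sup I f s) σ =
    Σ I λ i → Σ Λ λ t → Σ Λ λ t' →
      (σ ≡ t ∷ t' ∷ s i) × (t ⊩ᵖ subF a (f i)) × (t' ⊩ᵖ subF (f i) a)
  subF (sup I f s) b σ =
    Σ I λ i → Σ Λ λ t → (σ ≡ t ∷ s i) × (t ⊩ᵖ notinF (f i) b)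

  ‖_‖ : Formula → Stack → Set₁
  ‖ a ε̸ sup I f s ‖ π = Lift (lsuc lzero) (Σ I λ i → (f i ≈ a) × (s i ≡ π))
  ‖ a ≠ b ‖ π = Lift (lsuc lzero) (a ≈ b)
  ‖ a ∉ b ‖ = notinF a b
  ‖ a ⊆ b ‖ = subF a b
  ‖ φ ⇒ ψ ‖ σ = Σ Λ λ t → Σ Stack λ π → (σ ≡ t ∷ π) × (t ⊩ᵖ ‖ φ ‖) × ‖ ψ ‖ π
  ‖ ∀' φ ‖ π = Σ Name λ a → ‖ φ a ‖ π

  _⊩_ : Λ → Formula → Set₁
  t ⊩ φ = t ⊩ᵖ ‖ φ ‖

  Realized : Formula → Set₁
  Realized φ = Σ Λ λ t → NoCont t × (t ⊩ φ)

{-# OPTIONS --safe #-}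
module Submission where

-- Take y := r(β ∪ {β}) as the witness. Since α and β ∪ {β} have the same elements,
-- r(α) ≃ y is realized twice by the fixed point Incl ⋆ t.π ≻ t ⋆ Incl.Incl.π, which
-- realizes r(x) ⊆ r(y) whenever x ⊆ y. In z ∈ y ⇔ (z ∈ r(β) ∨ z ≃ r(β)), the backward
-- direction holds because ‖z ∉ y‖ contains both ‖z ∉ r(β)‖ and the stacks refuting
-- z ≃ r(β). For the forward one, a stack of ‖z ∉ y‖ provides z ≃ r(δ) with δ ∈ β + 1:
-- then z ⊆ r(β) as δ ⊆ β, and r(β) ⊆ z unless z ∈ r(β), by the key lemma that
-- ¬(δ ∈ β) → β ⊆ δ is realized for ordinals, by induction on δ and β simultaneously.

open import Defs
open import Level using (lift)
open import Data.Nat using (ℕ; zero; suc)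
open import Data.Fin using (Fin; zero; suc)
open import Data.Product using (_,_; proj₁; proj₂)
open import Data.Sum using (_⊎_; inj₁; inj₂; [_,_]′)
open import Data.Unit using (⊤; tt)
open import Data.Empty using (⊥)
open import Function using (_∘_; const; id)
open import Relation.Binary.PropositionalEquality
  using (_≡_; _≗_; refl; sym; trans; cong; cong₂)

_⊆ᵥ_ : VSet → VSet → Set₁
x ⊆ᵥ y = ∀ z → z ∈ᵥ x → z ∈ᵥ y

≐-refl : ∀ x → x ≐ x
≐-refl (sup I f) = (λ i → i , ≐-refl (f i)) , (λ i → i , ≐-refl (f i))

≐-sym : ∀ x y → x ≐ y → y ≐ x
≐-sym (sup I f) (sup J g) (fg , gf) =
  (λ j → let (i , e) = gf j in i , ≐-sym (f i) (g j) e) ,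
  (λ i → let (j , e) = fg i in j , ≐-sym (f i) (g j) e)

≐-trans : ∀ x y z → x ≐ y → y ≐ z → x ≐ z
≐-trans (sup I f) (sup J g) (sup K h) (fg , gf) (gh , hg) =
  (λ i → let (j , e) = fg i ; (k , e') = gh j in k , ≐-trans (f i) (g j) (h k) e e') ,
  (λ k → let (j , e') = hg k ; (i , e) = gf j in i , ≐-trans (f i) (g j) (h k) e e')

∈ᵥ-sup : ∀ I (f : I → VSet) i → f i ∈ᵥ sup I f
∈ᵥ-sup I f i = i , ≐-refl (f i)

≐⇒⊆ᵥ : ∀ x y → x ≐ y → x ⊆ᵥ y
≐⇒⊆ᵥ (sup I f) (sup J g) (fg , _) z (i , z≐fi) =
  let (j , e) = fg i in j , ≐-trans z (f i) (g j) z≐fi e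

ordinal-elem : ∀ I f → IsOrdinal (sup I f) → ∀ i → IsOrdinal (f i)
ordinal-elem I f (tr , trs) i =
  trs (f i) (∈ᵥ-sup I f i) , λ y y∈fi → trs y (tr (f i) (∈ᵥ-sup I f i) y y∈fi)

succᵥ-elem : ∀ I → (I → VSet) → I ⊎ ⊤ → VSet
succᵥ-elem I f = [ f , const (sup I f) ]′

succᵥ : VSet → VSet
succᵥ (sup I f) = sup (I ⊎ ⊤) (succᵥ-elem I f)

succᵥ-elem-⊆ : ∀ I f → IsTransitive (sup I f) → ∀ p → succᵥ-elem I f p ⊆ᵥ sup I f
succᵥ-elem-⊆ I f tr (inj₁ i) = tr (f i) (∈ᵥ-sup I f i)
succᵥ-elem-⊆ I f tr (inj₂ _) z z∈β = z∈β

succᵥ-elem-ordinal : ∀ I f → IsOrdinal (sup I f) → ∀ p →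
                     IsOrdinal (succᵥ-elem I f p)
succᵥ-elem-ordinal I f oβ (inj₁ i) = ordinal-elem I f oβ i
succᵥ-elem-ordinal I f oβ (inj₂ _) = oβ

successor-⊆-succᵥ : ∀ α β → IsSuccessorOf α β → α ⊆ᵥ succᵥ β
successor-⊆-succᵥ α (sup I f) α=β+1 z z∈α with proj₁ (α=β+1 z) z∈α
... | inj₁ (i , e) = inj₁ i , e
... | inj₂ e       = inj₂ tt , e

succᵥ-⊆-successor : ∀ α β → IsSuccessorOf α β → succᵥ β ⊆ᵥ α
succᵥ-⊆-successor α (sup I f) α=β+1 z (inj₁ i , e) = proj₂ (α=β+1 z) (inj₁ (i , e))
succᵥ-⊆-successor α (sup I f) α=β+1 z (inj₂ _ , e) = proj₂ (α=β+1 z) (inj₂ e)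

module Substitution (Ins Bot : Set) where
  open Syntax Ins Bot

  liftRen-cong : ∀ {n m} {ρ ρ' : Fin n → Fin m} → ρ ≗ ρ' → liftRen ρ ≗ liftRen ρ'
  liftRen-cong e zero    = refl
  liftRen-cong e (suc i) = cong suc (e i)

  ren-cong : ∀ {n m} {ρ ρ' : Fin n → Fin m} → ρ ≗ ρ' → ren ρ ≗ ren ρ'
  ren-cong e (var i) = cong var (e i)
  ren-cong e (t · u) = cong₂ _·_ (ren-cong e t) (ren-cong e u)
  ren-cong e (lam t) = cong lam (ren-cong (liftRen-cong e) t)
  ren-cong e cc      = refl
  ren-cong e (k π)   = refl
  ren-cong e (ins a) = refl

  ren-ren : ∀ {n m l} (ρ : Fin m → Fin l) (ρ' : Fin n → Fin m) →
            ren ρ ∘ ren ρ' ≗ ren (ρ ∘ ρ')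
  ren-ren ρ ρ' (var i) = refl
  ren-ren ρ ρ' (t · u) = cong₂ _·_ (ren-ren ρ ρ' t) (ren-ren ρ ρ' u)
  ren-ren ρ ρ' (lam t) =
    cong lam (trans (ren-ren (liftRen ρ) (liftRen ρ') t)
                    (ren-cong (λ { zero → refl ; (suc i) → refl }) t))
  ren-ren ρ ρ' cc      = refl
  ren-ren ρ ρ' (k π)   = refl
  ren-ren ρ ρ' (ins a) = refl

  liftSub-cong : ∀ {n m} {σ σ' : Fin n → Term m} → σ ≗ σ' → liftSub σ ≗ liftSub σ'
  liftSub-cong e zero    = refl
  liftSub-cong e (suc i) = cong (ren suc) (e i)

  sub-cong : ∀ {n m} {σ σ' : Fin n → Term m} → σ ≗ σ' → sub σ ≗ sub σ'
  sub-cong e (var i) = e i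
  sub-cong e (t · u) = cong₂ _·_ (sub-cong e t) (sub-cong e u)
  sub-cong e (lam t) = cong lam (sub-cong (liftSub-cong e) t)
  sub-cong e cc      = refl
  sub-cong e (k π)   = refl
  sub-cong e (ins a) = refl

  sub-ren : ∀ {n m l} (σ : Fin m → Term l) (ρ : Fin n → Fin m) →
            sub σ ∘ ren ρ ≗ sub (σ ∘ ρ)
  sub-ren σ ρ (var i) = refl
  sub-ren σ ρ (t · u) = cong₂ _·_ (sub-ren σ ρ t) (sub-ren σ ρ u)
  sub-ren σ ρ (lam t) =
    cong lam (trans (sub-ren (liftSub σ) (liftRen ρ) t)
                    (sub-cong (λ { zero → refl ; (suc i) → refl }) t))
  sub-ren σ ρ cc      = refl
  sub-ren σ ρ (k π)   = refl
  sub-ren σ ρ (ins a) = refl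

  ren-sub : ∀ {n m l} (ρ : Fin m → Fin l) (σ : Fin n → Term m) →
            ren ρ ∘ sub σ ≗ sub (ren ρ ∘ σ)
  ren-sub ρ σ (var i) = refl
  ren-sub ρ σ (t · u) = cong₂ _·_ (ren-sub ρ σ t) (ren-sub ρ σ u)
  ren-sub ρ σ (lam t) =
    cong lam (trans (ren-sub (liftRen ρ) (liftSub σ) t) (sub-cong lift-comm t))
    where
    lift-comm : ren (liftRen ρ) ∘ liftSub σ ≗ liftSub (ren ρ ∘ σ)
    lift-comm zero    = refl
    lift-comm (suc i) = trans (ren-ren (liftRen ρ) suc (σ i)) (sym (ren-ren suc ρ (σ i)))
  ren-sub ρ σ cc      = refl
  ren-sub ρ σ (k π)   = refl
  ren-sub ρ σ (ins a) = refl

  sub-sub : ∀ {n m l} (σ : Fin m → Term l) (τ : Fin n → Term m) →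
            sub σ ∘ sub τ ≗ sub (sub σ ∘ τ)
  sub-sub σ τ (var i) = refl
  sub-sub σ τ (t · u) = cong₂ _·_ (sub-sub σ τ t) (sub-sub σ τ u)
  sub-sub σ τ (lam t) =
    cong lam (trans (sub-sub (liftSub σ) (liftSub τ) t) (sub-cong lift-comm t))
    where
    lift-comm : sub (liftSub σ) ∘ liftSub τ ≗ liftSub (sub σ ∘ τ)
    lift-comm zero    = refl
    lift-comm (suc i) = trans (sub-ren (liftSub σ) suc (τ i)) (sym (ren-sub suc σ (τ i)))
  sub-sub σ τ cc      = refl
  sub-sub σ τ (k π)   = refl
  sub-sub σ τ (ins a) = refl

  sub-var : ∀ {n} → sub {n} var ≗ id
  sub-var (var i) = refl
  sub-var (t · u) = cong₂ _·_ (sub-var t) (sub-var u)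
  sub-var (lam t) =
    cong lam (trans (sub-cong (λ { zero → refl ; (suc i) → refl }) t) (sub-var t))
  sub-var cc      = refl
  sub-var (k π)   = refl
  sub-var (ins a) = refl

  sub-closed : (σ : Fin 0 → Λ) → sub σ ≗ id
  sub-closed σ t = trans (sub-cong (λ ()) t) (sub-var t)

  sub-weaken : (σ : Fin 1 → Λ) → sub σ ∘ ren suc ≗ id
  sub-weaken σ t = trans (sub-ren σ suc t) (sub-closed (σ ∘ suc) t)

  infixl 6 _▸_
  data Args : ℕ → Set where
    []  : Args zero
    _▸_ : ∀ {n} → Args n → Λ → Args (suc n)

  env : ∀ {n} → Args n → Fin n → Λ
  env (as ▸ a) zero    = a
  env (as ▸ a) (suc i) = env as i

  push : ∀ {n} → Args n → Stack → Stack
  push []       π = π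
  push (as ▸ a) π = push as (a ∷ π)

  apps : ∀ {n} → Λ → Args n → Λ
  apps t []       = t
  apps t (as ▸ a) = apps t as · a

  lamN : ∀ n → Term n → Λ
  lamN zero    b = b
  lamN (suc n) b = lamN n (lam b)

  sub-liftSub-[0:=] : ∀ {n} (as : Args n) (b : Term (suc n)) a →
                      sub (liftSub (env as)) b [0:= a ] ≡ sub (env (as ▸ a)) b
  sub-liftSub-[0:=] as b a =
    trans (sub-sub _ (liftSub (env as)) b)
          (sub-cong (λ { zero → refl ; (suc i) → sub-weaken _ (env as i) }) b)

module Combinators (Ins Bot : Set) where
  open Syntax Ins Bot

  -- Closed terms usable under any number of binders: substitution leaves them
  -- unchanged definitionally, so a body can mention other combinators.
  Combinator : Set
  Combinator = ∀ {n} → Term n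

  #0 : ∀ {n} → Term (suc n)
  #0 = var zero
  #1 : ∀ {n} → Term (suc (suc n))
  #1 = var (suc zero)
  #2 : ∀ {n} → Term (suc (suc (suc n)))
  #2 = var (suc (suc zero))
  #3 : ∀ {n} → Term (suc (suc (suc (suc n))))
  #3 = var (suc (suc (suc zero)))
  #4 : ∀ {n} → Term (suc (suc (suc (suc (suc n)))))
  #4 = var (suc (suc (suc (suc zero))))
  #5 : ∀ {n} → Term (suc (suc (suc (suc (suc (suc n))))))
  #5 = var (suc (suc (suc (suc (suc zero)))))

  θ Θ : Combinator
  θ = lam (lam (#0 · (#1 · #1 · #0)))
  Θ = θ · θ

  Pair DNI Contra : Combinator
  Pair   = lam (lam (lam (#0 · #2 · #1)))
  DNI    = lam (lam (#0 · #1))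
  Contra = lam (lam (lam (#1 · (#2 · #0))))

  Incl : Combinator
  Incl = Θ · lam (lam (#0 · #1 · #1))

  Trans₂ Trans₁ Trans : Combinator
  Trans₂ = lam (lam (lam (lam (lam (lam (#4 · (#5 · #3 · #1) · (#5 · #0 · #2)))))))
  Trans₁ = lam (lam (lam (lam (lam (#3 · (Trans₂ · #4 · #2 · #1 · #0))))))
  Trans  = Θ · lam (lam (lam (lam (#2 · (Trans₁ · #3 · #1 · #0)))))

  Restrict NotinCong : Combinator
  Restrict  = lam (lam (lam (#2 · (Trans · #1 · Incl) · (Trans · Incl · #0))))
  NotinCong = lam (lam (lam (lam (lam (#2 · (Trans · #4 · #1) · (Trans · #0 · #3))))))

  LinearStep Linear : Combinator
  LinearStep = lam (lam (lam (lam
    (#0 · (#3 · (DNI · #1)) · (#3 · (Contra · (Contra · Restrict) · #2))))))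
  Linear     = Θ · lam (lam (lam (#1 · (LinearStep · #2 · #1 · #0))))

  NotinSucc SuccElim SuccIntro : Combinator
  NotinSucc = lam (lam (lam (lam
    (#2 · (Pair · (Trans · #1 · Incl)
                · (Trans · (Linear · (Contra · (Contra · (NotinCong · #1 · #0)) · #3)) · #0))))))
  SuccElim  = lam (lam (lam (#2 · (NotinSucc · #1 · #0))))
  SuccIntro = lam (lam (#1 · (DNI · #0) · (DNI · #0)))

  successorRealizer : Combinator
  successorRealizer = DNI · (Pair · (Pair · SuccElim · SuccIntro) · (Pair · Incl · Incl))

module Realizers {Ins Bot : Set} (𝒜 : RealizabilityAlgebra Ins Bot) where
  open Syntax Ins Bot
  open Substitution Ins Bot
  open Combinators Ins Bot
  open RealizabilityAlgebra 𝒜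
  open Semantics 𝒜

  apps-≻ : ∀ {n} t (as : Args n) π → (apps t as ⋆ π) ≻ (t ⋆ push as π)
  apps-≻ t []       π = ≻-refl _
  apps-≻ t (as ▸ a) π = ≻-trans (≻-push (apps t as) a π) (apps-≻ t as (a ∷ π))

  ≡⇒≻ : ∀ {t u π} → t ≡ u → (t ⋆ π) ≻ (u ⋆ π)
  ≡⇒≻ refl = ≻-refl _

  lamN-≻ : ∀ n (b : Term n) (as : Args n) π →
           (lamN n b ⋆ push as π) ≻ (sub (env as) b ⋆ π)
  lamN-≻ zero    b []       π = ≡⇒≻ (sym (sub-closed _ b))
  lamN-≻ (suc n) b (as ▸ a) π =
    ≻-trans (lamN-≻ n (lam b) as (a ∷ π))
      (≻-trans (≻-grab (sub (liftSub (env as)) b) a π) (≡⇒≻ (sub-liftSub-[0:=] as b a)))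

  fix-≻ : ∀ F π → ((Θ · F) ⋆ π) ≻ (F ⋆ (Θ · F ∷ π))
  fix-≻ F π =
    ≻-trans (apps-≻ θ ([] ▸ θ ▸ F) π)
      (≻-trans (lamN-≻ 2 _ ([] ▸ θ ▸ F) π) (≻-push F (Θ · F) π))

  pair-≻ : ∀ a b f π → ((Pair · a · b) ⋆ (f ∷ π)) ≻ (f ⋆ (a ∷ b ∷ π))
  pair-≻ a b f π =
    ≻-trans (apps-≻ Pair ([] ▸ a ▸ b) (f ∷ π))
      (≻-trans (lamN-≻ 3 _ ([] ▸ a ▸ b ▸ f) π) (apps-≻ f ([] ▸ a ▸ b) π))

  dni-≻ : ∀ s a π → ((DNI · s) ⋆ (a ∷ π)) ≻ (a ⋆ (s ∷ π))
  dni-≻ s a π =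
    ≻-trans (apps-≻ DNI ([] ▸ s) (a ∷ π))
      (≻-trans (lamN-≻ 2 _ ([] ▸ s ▸ a) π) (≻-push a s π))

  contra-≻ : ∀ f a q π → ((Contra · f · a) ⋆ (q ∷ π)) ≻ (a ⋆ (f · q ∷ π))
  contra-≻ f a q π =
    ≻-trans (apps-≻ Contra ([] ▸ f ▸ a) (q ∷ π))
      (≻-trans (lamN-≻ 3 _ ([] ▸ f ▸ a ▸ q) π) (≻-push a (f · q) π))

  incl-≻ : ∀ t π → (Incl ⋆ (t ∷ π)) ≻ (t ⋆ (Incl ∷ Incl ∷ π))
  incl-≻ t π =
    ≻-trans (fix-≻ _ (t ∷ π))
      (≻-trans (lamN-≻ 2 _ ([] ▸ Incl ▸ t) π) (apps-≻ t ([] ▸ Incl ▸ Incl) π))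

  trans-≻ : ∀ t₁ t₂ r π →
            ((Trans · t₁ · t₂) ⋆ (r ∷ π)) ≻ (t₁ ⋆ (Trans₁ · Trans · t₂ · r ∷ π))
  trans-≻ t₁ t₂ r π =
    ≻-trans (apps-≻ Trans ([] ▸ t₁ ▸ t₂) (r ∷ π))
      (≻-trans (fix-≻ _ (t₁ ∷ t₂ ∷ r ∷ π))
        (≻-trans (lamN-≻ 4 _ ([] ▸ Trans ▸ t₁ ▸ t₂ ▸ r) π) (≻-push t₁ _ π)))

  trans₁-≻ : ∀ c t₂ r T₁ T₂ π →
             ((Trans₁ · c · t₂ · r) ⋆ (T₁ ∷ T₂ ∷ π)) ≻ (t₂ ⋆ (Trans₂ · c · r · T₁ · T₂ ∷ π))
  trans₁-≻ c t₂ r T₁ T₂ π =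
    ≻-trans (apps-≻ Trans₁ ([] ▸ c ▸ t₂ ▸ r) (T₁ ∷ T₂ ∷ π))
      (≻-trans (lamN-≻ 5 _ ([] ▸ c ▸ t₂ ▸ r ▸ T₁ ▸ T₂) π) (≻-push t₂ _ π))

  trans₂-≻ : ∀ c r T₁ T₂ U₁ U₂ π →
             ((Trans₂ · c · r · T₁ · T₂) ⋆ (U₁ ∷ U₂ ∷ π)) ≻
             (r ⋆ (c · T₁ · U₁ ∷ c · U₂ · T₂ ∷ π))
  trans₂-≻ c r T₁ T₂ U₁ U₂ π =
    ≻-trans (apps-≻ Trans₂ ([] ▸ c ▸ r ▸ T₁ ▸ T₂) (U₁ ∷ U₂ ∷ π))
      (≻-trans (lamN-≻ 6 _ ([] ▸ c ▸ r ▸ T₁ ▸ T₂ ▸ U₁ ▸ U₂) π)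
               (apps-≻ r ([] ▸ _ ▸ _) π))

  restrict-≻ : ∀ q T₁ T₂ π →
               ((Restrict · q) ⋆ (T₁ ∷ T₂ ∷ π)) ≻
               (q ⋆ (Trans · T₁ · Incl ∷ Trans · Incl · T₂ ∷ π))
  restrict-≻ q T₁ T₂ π =
    ≻-trans (apps-≻ Restrict ([] ▸ q) (T₁ ∷ T₂ ∷ π))
      (≻-trans (lamN-≻ 3 _ ([] ▸ q ▸ T₁ ▸ T₂) π) (apps-≻ q ([] ▸ _ ▸ _) π))

  notinCong-≻ : ∀ t t' q T₁ T₂ π →
                ((NotinCong · t · t' · q) ⋆ (T₁ ∷ T₂ ∷ π)) ≻
                (q ⋆ (Trans · t · T₁ ∷ Trans · T₂ · t' ∷ π))
  notinCong-≻ t t' q T₁ T₂ π =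
    ≻-trans (apps-≻ NotinCong ([] ▸ t ▸ t' ▸ q) (T₁ ∷ T₂ ∷ π))
      (≻-trans (lamN-≻ 5 _ ([] ▸ t ▸ t' ▸ q ▸ T₁ ▸ T₂) π)
               (apps-≻ q ([] ▸ _ ▸ _) π))

  linear-≻ : ∀ n s π → ((Linear · n) ⋆ (s ∷ π)) ≻ (n ⋆ (LinearStep · Linear · n · s ∷ π))
  linear-≻ n s π =
    ≻-trans (≻-push Linear n (s ∷ π))
      (≻-trans (fix-≻ _ (n ∷ s ∷ π))
        (≻-trans (lamN-≻ 3 _ ([] ▸ Linear ▸ n ▸ s) π) (≻-push n _ π)))

  linearStep-≻ : ∀ g n s q π → ((LinearStep · g · n · s) ⋆ (q ∷ π)) ≻
                 (q ⋆ (g · (DNI · s) ∷ g · (Contra · (Contra · Restrict) · n) ∷ π))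
  linearStep-≻ g n s q π =
    ≻-trans (apps-≻ LinearStep ([] ▸ g ▸ n ▸ s) (q ∷ π))
      (≻-trans (lamN-≻ 4 _ ([] ▸ g ▸ n ▸ s ▸ q) π) (apps-≻ q ([] ▸ _ ▸ _) π))

  notinSucc-≻ : ∀ v₁ v₂ t t' π →
                ((NotinSucc · v₁ · v₂) ⋆ (t ∷ t' ∷ π)) ≻
                (v₂ ⋆ (Pair · (Trans · t · Incl)
                            · (Trans · (Linear · (Contra · (Contra · (NotinCong · t · t')) · v₁)) · t')
                       ∷ π))
  notinSucc-≻ v₁ v₂ t t' π =
    ≻-trans (apps-≻ NotinSucc ([] ▸ v₁ ▸ v₂) (t ∷ t' ∷ π))
      (≻-trans (lamN-≻ 4 _ ([] ▸ v₁ ▸ v₂ ▸ t ▸ t') π) (≻-push v₂ _ π))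

  succElim-≻ : ∀ u v₁ v₂ π → (SuccElim ⋆ (u ∷ v₁ ∷ v₂ ∷ π)) ≻ (u ⋆ (NotinSucc · v₁ · v₂ ∷ π))
  succElim-≻ u v₁ v₂ π = ≻-trans (lamN-≻ 3 _ ([] ▸ u ▸ v₁ ▸ v₂) π) (≻-push u _ π)

  succIntro-≻ : ∀ d w π → (SuccIntro ⋆ (d ∷ w ∷ π)) ≻ (d ⋆ (DNI · w ∷ DNI · w ∷ π))
  succIntro-≻ d w π = ≻-trans (lamN-≻ 2 _ ([] ▸ d ▸ w) π) (apps-≻ d ([] ▸ _ ▸ _) π)

  ‖⊥'‖-all : ∀ π → ‖ ⊥' ‖ π
  ‖⊥'‖-all π = sup ⊥ (λ ()) (λ ()) , lift ((λ ()) , (λ ()))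

  pair-⊩ : ∀ φ ψ {a b} → a ⊩ φ → b ⊩ ψ → (Pair · a · b) ⊩ (φ ∧' ψ)
  pair-⊩ φ ψ {a} {b} ha hb π (f , ρ , refl , hf , hρ) =
    Pole-closed (pair-≻ a b f ρ) (hf _ (a , b ∷ ρ , refl , ha , (b , ρ , refl , hb , hρ)))

  dni-⊩ : ∀ φ {s} → s ⊩ φ → (DNI · s) ⊩ ¬' (¬' φ)
  dni-⊩ φ {s} hs π (a , ρ , refl , ha , hρ) =
    Pole-closed (dni-≻ s a ρ) (ha _ (s , ρ , refl , hs , hρ))

  exists-intro-⊩ : ∀ φ a {t} → t ⊩ φ a → (DNI · t) ⊩ ∃' φ
  exists-intro-⊩ φ a {t} ht π (h , ρ , refl , hh , hρ) =
    Pole-closed (dni-≻ t h ρ) (hh _ (a , (t , ρ , refl , ht , hρ)))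

  contra-⊩ : ∀ φ ψ {f a} → (∀ {q} → q ⊩ φ → (f · q) ⊩ ψ) →
             a ⊩ ¬' ψ → (Contra · f · a) ⊩ ¬' φ
  contra-⊩ φ ψ {f} {a} hf ha π (q , ρ , refl , hq , hρ) =
    Pole-closed (contra-≻ f a q ρ) (ha _ (f · q , ρ , refl , hf hq , hρ))

  contra²-⊩ : ∀ φ ψ {f n} → (∀ {q} → q ⊩ φ → (f · q) ⊩ ψ) →
              n ⊩ ¬' (¬' φ) → (Contra · (Contra · f) · n) ⊩ ¬' (¬' ψ)
  contra²-⊩ φ ψ hf = contra-⊩ (¬' ψ) (¬' φ) (contra-⊩ φ ψ hf)

  incl-⊩ : ∀ x y → x ⊆ᵥ y → Incl ⊩ (reish x ⊆ reish y)
  incl-⊩ (sup I f) (sup J g) x⊆y π ((i , σ) , t , refl , ht) =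
    Pole-closed (incl-≻ t σ)
      (ht _ ((j , σ) , Incl , Incl , refl ,
             incl-⊩ (f i) (g j) (≐⇒⊆ᵥ (f i) (g j) fᵢ≐gⱼ) ,
             incl-⊩ (g j) (f i) (≐⇒⊆ᵥ (g j) (f i) (≐-sym (f i) (g j) fᵢ≐gⱼ))))
    where
    j = proj₁ (x⊆y (f i) (∈ᵥ-sup I f i))
    fᵢ≐gⱼ = proj₂ (x⊆y (f i) (∈ᵥ-sup I f i))

  trans-⊩ : ∀ a b c {t₁ t₂} → t₁ ⊩ (a ⊆ b) → t₂ ⊩ (b ⊆ c) → (Trans · t₁ · t₂) ⊩ (a ⊆ c)
  trans-⊩ (sup I f s) (sup J g u) (sup K h w) {t₁} {t₂} ht₁ ht₂ π (i , r , refl , hr) =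
    Pole-closed (trans-≻ t₁ t₂ r (s i)) (ht₁ _ (i , _ , refl , fᵢ∉b))
    where
    fᵢ∉b : (Trans₁ · Trans · t₂ · r) ⊩ (f i ∉ sup J g u)
    fᵢ∉b σ (j , T₁ , T₂ , refl , hT₁ , hT₂) =
      Pole-closed (trans₁-≻ Trans t₂ r T₁ T₂ (u j)) (ht₂ _ (j , _ , refl , gⱼ∉c))
      where
      gⱼ∉c : (Trans₂ · Trans · r · T₁ · T₂) ⊩ (g j ∉ sup K h w)
      gⱼ∉c σ' (l , U₁ , U₂ , refl , hU₁ , hU₂) =
        Pole-closed (trans₂-≻ Trans r T₁ T₂ U₁ U₂ (w l))
          (hr _ (l , _ , _ , refl ,
                 trans-⊩ (f i) (g j) (h l) hT₁ hU₁ , trans-⊩ (h l) (g j) (f i) hU₂ hT₂))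

  restrict-⊩ : ∀ a x y {q} → x ⊆ᵥ y → q ⊩ (a ∉ reish y) → (Restrict · q) ⊩ (a ∉ reish x)
  restrict-⊩ a (sup K h) (sup J g) {q} x⊆y hq π ((l , ρ) , T₁ , T₂ , refl , hT₁ , hT₂) =
    Pole-closed (restrict-≻ q T₁ T₂ ρ)
      (hq _ ((j , ρ) , _ , _ , refl ,
             trans-⊩ a (reish (h l)) (reish (g j)) hT₁
               (incl-⊩ (h l) (g j) (≐⇒⊆ᵥ (h l) (g j) hₗ≐gⱼ)) ,
             trans-⊩ (reish (g j)) (reish (h l)) a
               (incl-⊩ (g j) (h l) (≐⇒⊆ᵥ (g j) (h l) (≐-sym (h l) (g j) hₗ≐gⱼ))) hT₂))
    where
    j = proj₁ (x⊆y (h l) (∈ᵥ-sup K h l))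
    hₗ≐gⱼ = proj₂ (x⊆y (h l) (∈ᵥ-sup K h l))

  notinCong-⊩ : ∀ z a b {t t' q} → t ⊩ (z ⊆ a) → t' ⊩ (a ⊆ z) →
                q ⊩ (z ∉ b) → (NotinCong · t · t' · q) ⊩ (a ∉ b)
  notinCong-⊩ z a (sup J g u) {t} {t'} {q} ht ht' hq π (j , T₁ , T₂ , refl , hT₁ , hT₂) =
    Pole-closed (notinCong-≻ t t' q T₁ T₂ (u j))
      (hq _ (j , _ , _ , refl , trans-⊩ z a (g j) ht hT₁ , trans-⊩ (g j) a z hT₂ ht'))

  linear-⊩ : ∀ δ β {n} → IsOrdinal δ → IsOrdinal β →
             n ⊩ ¬' (reish δ ∈' reish β) → (Linear · n) ⊩ (reish β ⊆ reish δ)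
  linear-⊩ δ (sup I f) {n} oδ oβ hn π ((i , σ) , s , refl , hs) =
    Pole-closed (linear-≻ n s σ) (hn _ (_ , σ , refl , δ∈β , ‖⊥'‖-all σ))
    where
    -- ε := f i is in β but not in δ; the two induction hypotheses give δ ≃ ε, so δ ∈ β.
    oε = ordinal-elem I f oβ i
    ε⊆β = proj₁ oβ (f i) (∈ᵥ-sup I f i)
    δ∈β : (LinearStep · Linear · n · s) ⊩ (reish δ ∈' reish (sup I f))
    δ∈β π' (q , ρ , refl , hq , _) =
      Pole-closed (linearStep-≻ Linear n s q ρ)
        (hq _ ((i , ρ) , _ , _ , refl ,
               linear-⊩ (f i) δ oε oδ (dni-⊩ (reish (f i) ∉ reish δ) hs) ,
               linear-⊩ δ (f i) oδ oε
                 (contra²-⊩ (reish δ ∉ reish (sup I f)) (reish δ ∉ reish (f i))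
                            (restrict-⊩ (reish δ) (f i) (sup I f) ε⊆β) hn)))

  notinSucc-⊩ : ∀ β z {v₁ v₂} → IsOrdinal β →
                v₁ ⊩ ¬' (z ∈' reish β) → v₂ ⊩ ¬' (z ≃' reish β) →
                (NotinSucc · v₁ · v₂) ⊩ (z ∉ reish (succᵥ β))
  notinSucc-⊩ (sup I f) z {v₁} {v₂} oβ hv₁ hv₂ π ((p , σ) , t , t' , refl , ht , ht') =
    Pole-closed (notinSucc-≻ v₁ v₂ t t' σ)
      (hv₂ _ (_ , σ , refl ,
              pair-⊩ (z ⊆ rβ) (rβ ⊆ z)
                (trans-⊩ z rδ rβ ht (incl-⊩ δ β (succᵥ-elem-⊆ I f (proj₁ oβ) p)))
                (trans-⊩ rβ rδ z (linear-⊩ δ β (succᵥ-elem-ordinal I f oβ p) oβ δ∉β) ht') ,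
              ‖⊥'‖-all σ))
    where
    β = sup I f
    rβ = reish β
    δ = succᵥ-elem I f p
    rδ = reish δ
    δ∉β : (Contra · (Contra · (NotinCong · t · t')) · v₁) ⊩ ¬' (rδ ∈' rβ)
    δ∉β = contra²-⊩ (z ∉ rβ) (rδ ∉ rβ) (notinCong-⊩ z rδ rβ ht ht') hv₁

  succElim-⊩ : ∀ β z → IsOrdinal β →
               SuccElim ⊩ ((z ∈' reish (succᵥ β)) ⇒ ((z ∈' reish β) ∨' (z ≃' reish β)))
  succElim-⊩ β z oβ π
    (u , _ , refl , hu , (v₁ , _ , refl , hv₁ , (v₂ , ρ , refl , hv₂ , hρ))) =
    Pole-closed (succElim-≻ u v₁ v₂ ρ) (hu _ (_ , ρ , refl , notinSucc-⊩ β z oβ hv₁ hv₂ , hρ))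

  succIntro-⊩ : ∀ β z →
                SuccIntro ⊩ (((z ∈' reish β) ∨' (z ≃' reish β)) ⇒ (z ∈' reish (succᵥ β)))
  succIntro-⊩ (sup I f) z π (d , _ , refl , hd , (w , ρ , refl , hw , hρ)) =
    Pole-closed (succIntro-≻ d w ρ)
      (hd _ (_ , _ , refl , dni-⊩ (z ∉ rβ) w⊩z∉β ,
             (_ , ρ , refl , dni-⊩ (z ⊆ rβ ⇒ ¬' (rβ ⊆ z)) w⊩z≄β , hρ)))
    where
    rβ = reish (sup I f)
    w⊩z∉β : w ⊩ (z ∉ rβ)
    w⊩z∉β σ ((j , σ') , t , t' , refl , ht , ht') =
      hw _ ((inj₁ j , σ') , t , t' , refl , ht , ht')
    w⊩z≄β : w ⊩ (z ⊆ rβ ⇒ ¬' (rβ ⊆ z))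
    w⊩z≄β σ (t , _ , refl , ht , (t' , σ' , refl , ht' , _)) =
      hw _ ((inj₂ tt , σ') , t , t' , refl , ht , ht')

  isSucc-⊩ : ∀ β → IsOrdinal β →
             (Pair · SuccElim · SuccIntro) ⊩ IsSucc' (reish (succᵥ β)) (reish β)
  isSucc-⊩ β oβ π (z , hz) =
    pair-⊩ (z ∈' y ⇒ z∈β∨z≃β) (z∈β∨z≃β ⇒ z ∈' y) (succElim-⊩ β z oβ) (succIntro-⊩ β z) π hz
    where
    y = reish (succᵥ β)
    z∈β∨z≃β = (z ∈' reish β) ∨' (z ≃' reish β)

  successor-⊩ : ∀ α β → IsOrdinal β → IsSuccessorOf α β →
                successorRealizer ⊩ (reish α ≃Succ reish β)
  successor-⊩ α β oβ α=β+1 =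
    exists-intro-⊩ (λ y → IsSucc' y rβ ∧' (reish α ≃' y)) y
      (pair-⊩ (IsSucc' y rβ) (reish α ≃' y)
        (isSucc-⊩ β oβ)
        (pair-⊩ (reish α ⊆ y) (y ⊆ reish α)
          (incl-⊩ α (succᵥ β) (successor-⊆-succᵥ α β α=β+1))
          (incl-⊩ (succᵥ β) α (succᵥ-⊆-successor α β α=β+1))))
    where
    rβ = reish β
    y = reish (succᵥ β)

mainTheorem16 : {Ins Bot : Set} (𝒜 : RealizabilityAlgebra Ins Bot) (α β : VSet) →
    IsOrdinal α → IsOrdinal β → IsSuccessorOf α β →
    Semantics.Realized 𝒜 (Syntax._≃Succ_ Ins Bot (Syntax.reish Ins Bot α) (Syntax.reish Ins Bot β))
-- NoCont of the
-- concrete realizer computes to a product of ⊤s.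
mainTheorem16 {Ins} {Bot} 𝒜 α β _ β-ordinal α=β+1 =
  successorRealizer , _ , successor-⊩ α β β-ordinal α=β+1
  where
  open Combinators Ins Bot
  open Realizers 𝒜
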